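{- Let $n\geq1$ and $e\in\mathbf{I}_n(\geq,\geq,>)$ with parameters $(p,q)$. Then there are exactly $p+q$ inversion sequences in $\mathbf{I}_{n+1}(\geq,\geq,>)$ whose first $n$ entries form $e$; namely $(e_1,\ldots,e_n,j)$ for $c\leq j\leq n$, where $c=n+1-(p+q)$. Listed in order of increasing last entry $j=c,c+1,\ldots,n$, their parameters are respectively $$(p-1,q+1),(p-2,q+1),\ldots,(1,q+1),\ (1,q+1),\ (p+1,q),(p+2,q-1),\ldots,(p+q,1).$$
   Context: $\mathbf{I}_n=\{(e_1,\ldots,e_n): 0\leq e_i<i\}$. $\mathbf{I}_n(\geq,\geq,>)$ is the set of $e\in\mathbf{I}_n$ with no $i<j<k$ such that $e_i\geq e_j\geq e_k$ and $e_i>e_k$. For $e\in\mathbf{I}_n(\geq,\geq,>)$, $\mathrm{cri}(e)$ is the minimal integer $c\geq0$ such that $(e_1,\ldots,e_n,c)\in\mathbf{I}_{n+1}(\geq,\geq,>)$. With $m=\max\{e_1,\ldots,e_n\}$, the parameters of $e$ are $(p,q)$ where $p=m+1-\mathrm{cri}(e)$ and $q=n-m$. -}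

module Defs where

open import Data.Nat using (ℕ; zero; suc; _+_; _∸_; _≤_; _<_; _≥_; _>_; _⊔_)
open import Data.Fin using (Fin; toℕ) renaming (_<_ to _<ᶠ_)
open import Data.Vec using (Vec; lookup; foldr; _∷ʳ_)
open import Data.Product using (Σ; _×_)
open import Relation.Nullary using (¬_)
open import Relation.Binary.PropositionalEquality using (_≡_)

-- Entries are 0-indexed positions: position i (0-based) is e_{i+1}, and
-- the condition 0 ≤ e_{i+1} < i+1 reads  lookup e i ≤ toℕ i.
IsInvSeq : {n : ℕ} → Vec ℕ n → Set
IsInvSeq {n} e = (i : Fin n) → lookup e i ≤ toℕ i

Avoids≥≥> : {n : ℕ} → Vec ℕ n → Set
Avoids≥≥> {n} e = (i j k : Fin n) → i <ᶠ j → j <ᶠ k →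
  ¬ (lookup e i ≥ lookup e j × lookup e j ≥ lookup e k × lookup e i > lookup e k)

InI : {n : ℕ} → Vec ℕ n → Set
InI e = IsInvSeq e × Avoids≥≥> e

IsCri : {n : ℕ} → Vec ℕ n → ℕ → Set
IsCri e c = InI (e ∷ʳ c) × ((c' : ℕ) → c' < c → ¬ InI (e ∷ʳ c'))

maxEntry : {n : ℕ} → Vec ℕ n → ℕ
maxEntry e = foldr _ _⊔_ 0 e

HasParams : {n : ℕ} → Vec ℕ n → ℕ → ℕ → Set
HasParams {n} e p q =
  Σ ℕ (λ c → IsCri e c × p ≡ suc (maxEntry e) ∸ c × q ≡ n ∸ maxEntry e)

-- Write m = max e and c = cri(e). Appending y to e is allowed exactly when y ≤ n and no two
-- earlier entries a ≥ b (a first) satisfy b ≥ y and a > y. Such a pair for y also serves every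
-- smaller value, so the allowed last entries form the interval c ≤ y ≤ n. For the extension
-- by j, the new critical value depends on whether j can serve as the second entry of such a
-- pair: if j < m, the pair (m, j) rules out every y ≤ j while j + 1 stays allowed, so the new
-- value is j + 1; if j = m, the pair (m, m) rules out every y < m, so it is m; if j > m, no
-- earlier entry is ≥ j, so it stays c. With the new maxima m, m and j this gives the listed
-- parameters.
module Submission where

open import Defs
open import Data.Nat using (ℕ; suc; _+_; _∸_; _≤_; _<_; _≥_; _>_; _⊔_; z≤n; s≤s; s≤s⁻¹)
open import Data.Nat.Properties
import Data.Fin as Fin
open import Data.Fin using (Fin; toℕ; inject₁; fromℕ; zero; suc)
open import Data.Fin.Properties using (toℕ<n; toℕ-inject₁; toℕ-fromℕ; ≤fromℕ; inject₁ℕ<)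
open import Data.Fin.Relation.Unary.Top using (view; ‵fromℕ; ‵inject₁)
open import Data.Vec using (Vec; []; _∷_; lookup; _∷ʳ_)
open import Data.Product using (Σ-syntax; ∃; _×_; _,_; proj₁; proj₂)
open import Data.Sum using (_⊎_; inj₁; inj₂)
open import Function.Base using (_∘_)
open import Function.Bundles using (_⇔_; mk⇔; Equivalence)
open import Relation.Nullary using (¬_; contradiction)
open import Relation.Binary.PropositionalEquality

lookup-∷ʳ-inject₁ : ∀ {a} {A : Set a} {n} (xs : Vec A n) x (i : Fin n) →
  lookup (xs ∷ʳ x) (inject₁ i) ≡ lookup xs i
lookup-∷ʳ-inject₁ (y ∷ xs) x zero    = refl
lookup-∷ʳ-inject₁ (y ∷ xs) x (suc i) = lookup-∷ʳ-inject₁ xs x i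

lookup-∷ʳ-fromℕ : ∀ {a} {A : Set a} {n} (xs : Vec A n) x → lookup (xs ∷ʳ x) (fromℕ n) ≡ x
lookup-∷ʳ-fromℕ []       x = refl
lookup-∷ʳ-fromℕ (y ∷ xs) x = lookup-∷ʳ-fromℕ xs x

inject₁-mono-< : ∀ {n} {i j : Fin n} → i Fin.< j → inject₁ i Fin.< inject₁ j
inject₁-mono-< {i = i} {j} = subst₂ _<_ (sym (toℕ-inject₁ i)) (sym (toℕ-inject₁ j))

inject₁-cancel-< : ∀ {n} {i j : Fin n} → inject₁ i Fin.< inject₁ j → i Fin.< j
inject₁-cancel-< {i = i} {j} = subst₂ _<_ (toℕ-inject₁ i) (toℕ-inject₁ j)

inject₁<fromℕ : ∀ {n} (i : Fin n) → inject₁ i Fin.< fromℕ n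
inject₁<fromℕ {n} i = subst (toℕ (inject₁ i) <_) (sym (toℕ-fromℕ n)) (inject₁ℕ< i)

fromℕ≮ : ∀ {n} (i : Fin (suc n)) → ¬ fromℕ n Fin.< i
fromℕ≮ i fromℕ<i = <⇒≱ fromℕ<i (≤fromℕ i)

m+n≡o⇒n≡o∸m : ∀ {m n o} → m + n ≡ o → n ≡ o ∸ m
m+n≡o⇒n≡o∸m {m} {n} refl = sym (m+n∸m≡n m n)

+-suc-shift : ∀ m n o → m + suc n + o ≡ m + n + suc o
+-suc-shift m n o = trans (cong (_+ o) (+-suc m n)) (sym (+-suc (m + n) o))

lookup≤maxEntry : ∀ {n} (e : Vec ℕ n) i → lookup e i ≤ maxEntry e
lookup≤maxEntry (x ∷ e) zero    = m≤m⊔n x (maxEntry e)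
lookup≤maxEntry (x ∷ e) (suc i) = ≤-trans (lookup≤maxEntry e i) (m≤n⊔m x (maxEntry e))

maxEntry-lub : ∀ {n b} (e : Vec ℕ n) → (∀ i → lookup e i ≤ b) → maxEntry e ≤ b
maxEntry-lub []      _      = z≤n
maxEntry-lub (x ∷ e) bounds = ⊔-lub (bounds zero) (maxEntry-lub e (bounds ∘ suc))

lookup-maxEntry : ∀ {n} (e : Vec ℕ n) → 0 < maxEntry e → ∃ λ i → lookup e i ≡ maxEntry e
lookup-maxEntry (x ∷ e) 0<max with ≤-total (maxEntry e) x
... | inj₁ max≤x = zero , sym (m≥n⇒m⊔n≡m max≤x)
... | inj₂ x≤max with lookup-maxEntry e (subst (0 <_) (m≤n⇒m⊔n≡n x≤max) 0<max)
...   | i , eq = suc i , trans eq (sym (m≤n⇒m⊔n≡n x≤max))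

maxEntry-∷ʳ : ∀ {n} (e : Vec ℕ n) x → maxEntry (e ∷ʳ x) ≡ maxEntry e ⊔ x
maxEntry-∷ʳ []      x = ⊔-identityʳ x
maxEntry-∷ʳ (y ∷ e) x = trans (cong (y ⊔_) (maxEntry-∷ʳ e x)) (sym (⊔-assoc y (maxEntry e) x))

maxEntry-∷ʳ-≤ : ∀ {n} (e : Vec ℕ n) {x} → x ≤ maxEntry e → maxEntry (e ∷ʳ x) ≡ maxEntry e
maxEntry-∷ʳ-≤ e {x} x≤max = trans (maxEntry-∷ʳ e x) (m≥n⇒m⊔n≡m x≤max)

maxEntry-∷ʳ-≥ : ∀ {n} (e : Vec ℕ n) {x} → maxEntry e ≤ x → maxEntry (e ∷ʳ x) ≡ x
maxEntry-∷ʳ-≥ e {x} max≤x = trans (maxEntry-∷ʳ e x) (m≤n⇒m⊔n≡n max≤x)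

maxEntry≤length : ∀ {n} (e : Vec ℕ n) → IsInvSeq e → maxEntry e ≤ n
maxEntry≤length e inv = maxEntry-lub e (λ i → ≤-trans (inv i) (<⇒≤ (toℕ<n i)))

ForbiddingPair : ℕ → ℕ → ℕ → Set
ForbiddingPair a b y = a ≥ b × b ≥ y × a > y

ForbiddingPair-cong : ∀ {a a′ b b′ y y′} → a ≡ a′ → b ≡ b′ → y ≡ y′ →
  ForbiddingPair a b y → ForbiddingPair a′ b′ y′
ForbiddingPair-cong refl refl refl pair = pair

Forbids : ∀ {n} → Vec ℕ n → ℕ → Set
Forbids {n} e y =
  Σ[ i ∈ Fin n ] Σ[ j ∈ Fin n ] (i Fin.< j × ForbiddingPair (lookup e i) (lookup e j) y)

Forbids-anti : ∀ {n} (e : Vec ℕ n) {y z} → Forbids e y → z ≤ y → Forbids e z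
Forbids-anti _ (i , j , i<j , a≥b , b≥y , a>y) z≤y =
  i , j , i<j , a≥b , ≤-trans z≤y b≥y , ≤-<-trans z≤y a>y

Forbids⇒<maxEntry : ∀ {n} (e : Vec ℕ n) {y} → Forbids e y → y < maxEntry e
Forbids⇒<maxEntry e (i , _ , _ , _ , _ , a>y) = <-≤-trans a>y (lookup≤maxEntry e i)

module _ {n} (e : Vec ℕ n) (x : ℕ) where

  Forbids-∷ʳ⁺ˡ : ∀ {y} → Forbids e y → Forbids (e ∷ʳ x) y
  Forbids-∷ʳ⁺ˡ (i , j , i<j , pair) =
    inject₁ i , inject₁ j , inject₁-mono-< i<j ,
    ForbiddingPair-cong (sym (lookup-∷ʳ-inject₁ e x i)) (sym (lookup-∷ʳ-inject₁ e x j)) refl pair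

  Forbids-∷ʳ⁺ʳ : ∀ {y} (i : Fin n) → ForbiddingPair (lookup e i) x y → Forbids (e ∷ʳ x) y
  Forbids-∷ʳ⁺ʳ i pair =
    inject₁ i , fromℕ n , inject₁<fromℕ i ,
    ForbiddingPair-cong (sym (lookup-∷ʳ-inject₁ e x i)) (sym (lookup-∷ʳ-fromℕ e x)) refl pair

  Forbids-∷ʳ⁻ : ∀ {y} → Forbids (e ∷ʳ x) y →
    Forbids e y ⊎ ∃ λ i → ForbiddingPair (lookup e i) x y
  Forbids-∷ʳ⁻ (i , j , i<j , pair) with view i | view j
  ... | ‵fromℕ      | _           = contradiction i<j (fromℕ≮ j)
  ... | ‵inject₁ i′ | ‵inject₁ j′ =
    inj₁ (i′ , j′ , inject₁-cancel-< i<j ,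
          ForbiddingPair-cong (lookup-∷ʳ-inject₁ e x i′) (lookup-∷ʳ-inject₁ e x j′) refl pair)
  ... | ‵inject₁ i′ | ‵fromℕ      =
    inj₂ (i′ , ForbiddingPair-cong (lookup-∷ʳ-inject₁ e x i′) (lookup-∷ʳ-fromℕ e x) refl pair)

  InI-∷ʳ⁻ : InI (e ∷ʳ x) → InI e × x ≤ n × ¬ Forbids e x
  InI-∷ʳ⁻ (inv , avoids) = (inv′ , avoids′) , x≤n , ¬forbids
    where
    inv′ : IsInvSeq e
    inv′ i = subst₂ _≤_ (lookup-∷ʳ-inject₁ e x i) (toℕ-inject₁ i) (inv (inject₁ i))
    avoids′ : Avoids≥≥> e
    avoids′ i j k i<j j<k triple =
      avoids (inject₁ i) (inject₁ j) (inject₁ k) (inject₁-mono-< i<j) (inject₁-mono-< j<k)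
        (ForbiddingPair-cong (sym (lookup-∷ʳ-inject₁ e x i)) (sym (lookup-∷ʳ-inject₁ e x j))
                             (sym (lookup-∷ʳ-inject₁ e x k)) triple)
    x≤n : x ≤ n
    x≤n = subst₂ _≤_ (lookup-∷ʳ-fromℕ e x) (toℕ-fromℕ n) (inv (fromℕ n))
    ¬forbids : ¬ Forbids e x
    ¬forbids (i , j , i<j , pair) =
      avoids (inject₁ i) (inject₁ j) (fromℕ n) (inject₁-mono-< i<j) (inject₁<fromℕ j)
        (ForbiddingPair-cong (sym (lookup-∷ʳ-inject₁ e x i)) (sym (lookup-∷ʳ-inject₁ e x j))
                             (sym (lookup-∷ʳ-fromℕ e x)) pair)

  InI-∷ʳ⁺ : InI e → x ≤ n → ¬ Forbids e x → InI (e ∷ʳ x)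
  InI-∷ʳ⁺ (inv , avoids) x≤n ¬forbids = inv′ , avoids′
    where
    inv′ : IsInvSeq (e ∷ʳ x)
    inv′ i with view i
    ... | ‵fromℕ      = subst₂ _≤_ (sym (lookup-∷ʳ-fromℕ e x)) (sym (toℕ-fromℕ n)) x≤n
    ... | ‵inject₁ i′ =
      subst₂ _≤_ (sym (lookup-∷ʳ-inject₁ e x i′)) (sym (toℕ-inject₁ i′)) (inv i′)
    avoids′ : Avoids≥≥> (e ∷ʳ x)
    avoids′ i j k i<j j<k triple with view i | view j | view k
    ... | ‵fromℕ      | _           | _           = fromℕ≮ j i<j
    ... | _           | ‵fromℕ      | _           = fromℕ≮ k j<k
    ... | ‵inject₁ i′ | ‵inject₁ j′ | ‵inject₁ k′ =
      avoids i′ j′ k′ (inject₁-cancel-< i<j) (inject₁-cancel-< j<k)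
        (ForbiddingPair-cong (lookup-∷ʳ-inject₁ e x i′) (lookup-∷ʳ-inject₁ e x j′)
                             (lookup-∷ʳ-inject₁ e x k′) triple)
    ... | ‵inject₁ i′ | ‵inject₁ j′ | ‵fromℕ      =
      ¬forbids (i′ , j′ , inject₁-cancel-< i<j ,
        ForbiddingPair-cong (lookup-∷ʳ-inject₁ e x i′) (lookup-∷ʳ-inject₁ e x j′)
                            (lookup-∷ʳ-fromℕ e x) triple)

Forbids⇒¬InI-∷ʳ : ∀ {n} (e : Vec ℕ n) {y} → Forbids e y → ¬ InI (e ∷ʳ y)
Forbids⇒¬InI-∷ʳ e {y} forbids ey∈I = proj₂ (proj₂ (InI-∷ʳ⁻ e y ey∈I)) forbids

Forbids-∷ʳ-≤maxEntry : ∀ {n} (e : Vec ℕ n) {x y} →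
  y ≤ x → x ≤ maxEntry e → y < maxEntry e → Forbids (e ∷ʳ x) y
Forbids-∷ʳ-≤maxEntry e y≤x x≤max y<max with lookup-maxEntry e (≤-<-trans z≤n y<max)
... | i , eᵢ≡max =
  Forbids-∷ʳ⁺ʳ e _ i (ForbiddingPair-cong (sym eᵢ≡max) refl refl (x≤max , y≤x , y<max))

Forbids-∷ʳ⁻-above : ∀ {n} (e : Vec ℕ n) {x y} →
  maxEntry e < x → Forbids (e ∷ʳ x) y → Forbids e y
Forbids-∷ʳ⁻-above e max<x forbids with Forbids-∷ʳ⁻ e _ forbids
... | inj₁ forbids′          = forbids′
... | inj₂ (i , eᵢ≥x , _ , _) = contradiction eᵢ≥x (<⇒≱ (≤-<-trans (lookup≤maxEntry e i) max<x))

module CriticalValue {n} (e : Vec ℕ n) (e∈I : InI e) {c} (c-cri : IsCri e c) where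

  ¬Forbids-cri : ¬ Forbids e c
  ¬Forbids-cri = proj₂ (proj₂ (InI-∷ʳ⁻ e c (proj₁ c-cri)))

  cri≤n : c ≤ n
  cri≤n = proj₁ (proj₂ (InI-∷ʳ⁻ e c (proj₁ c-cri)))

  InI-∷ʳ⇔ : ∀ j → InI (e ∷ʳ j) ⇔ (c ≤ j × j ≤ n)
  InI-∷ʳ⇔ j = mk⇔
    (λ ej∈I → ≮⇒≥ (λ j<c → proj₂ c-cri j j<c ej∈I) , proj₁ (proj₂ (InI-∷ʳ⁻ e j ej∈I)))
    (λ (c≤j , j≤n) → InI-∷ʳ⁺ e j e∈I j≤n (λ forbids → ¬Forbids-cri (Forbids-anti e forbids c≤j)))

  maxEntry≤n : maxEntry e ≤ n
  maxEntry≤n = maxEntry≤length e (proj₁ e∈I)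

  cri≤maxEntry : c ≤ maxEntry e
  cri≤maxEntry = ≮⇒≥ λ max<c → proj₂ c-cri _ max<c
    (InI-∷ʳ⁺ e _ e∈I maxEntry≤n (λ forbids → <-irrefl refl (Forbids⇒<maxEntry e forbids)))

  IsCri-∷ʳ-below : ∀ {j} → c ≤ j → j < maxEntry e → IsCri (e ∷ʳ j) (suc j)
  IsCri-∷ʳ-below {j} c≤j j<max = InI-∷ʳ⁺ (e ∷ʳ j) (suc j) ej∈I (s≤s j≤n) ¬forbids , least
    where
    j≤n : j ≤ n
    j≤n = ≤-trans (<⇒≤ j<max) maxEntry≤n
    ej∈I : InI (e ∷ʳ j)
    ej∈I = Equivalence.from (InI-∷ʳ⇔ j) (c≤j , j≤n)
    ¬forbids : ¬ Forbids (e ∷ʳ j) (suc j)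
    ¬forbids forbids with Forbids-∷ʳ⁻ e j forbids
    ... | inj₁ forbids′          = ¬Forbids-cri (Forbids-anti e forbids′ (m≤n⇒m≤1+n c≤j))
    ... | inj₂ (_ , _ , j≥1+j , _) = 1+n≰n j≥1+j
    least : ∀ y → y < suc j → ¬ InI (e ∷ʳ j ∷ʳ y)
    least y y<1+j = Forbids⇒¬InI-∷ʳ (e ∷ʳ j)
      (Forbids-∷ʳ-≤maxEntry e (s≤s⁻¹ y<1+j) (<⇒≤ j<max) (<-≤-trans y<1+j j<max))

  IsCri-∷ʳ-maxEntry : IsCri (e ∷ʳ maxEntry e) (maxEntry e)
  IsCri-∷ʳ-maxEntry = InI-∷ʳ⁺ (e ∷ʳ _) _ emax∈I (m≤n⇒m≤1+n maxEntry≤n) ¬forbids , least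
    where
    emax∈I : InI (e ∷ʳ maxEntry e)
    emax∈I = Equivalence.from (InI-∷ʳ⇔ _) (cri≤maxEntry , maxEntry≤n)
    ¬forbids : ¬ Forbids (e ∷ʳ maxEntry e) (maxEntry e)
    ¬forbids forbids with Forbids-∷ʳ⁻ e _ forbids
    ... | inj₁ forbids′          = <-irrefl refl (Forbids⇒<maxEntry e forbids′)
    ... | inj₂ (i , _ , _ , eᵢ>max) = <⇒≱ eᵢ>max (lookup≤maxEntry e i)
    least : ∀ y → y < maxEntry e → ¬ InI (e ∷ʳ maxEntry e ∷ʳ y)
    least y y<max = Forbids⇒¬InI-∷ʳ (e ∷ʳ maxEntry e)
      (Forbids-∷ʳ-≤maxEntry e (<⇒≤ y<max) ≤-refl y<max)

  IsCri-∷ʳ-above : ∀ {j} → maxEntry e < j → j ≤ n → IsCri (e ∷ʳ j) c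
  IsCri-∷ʳ-above {j} max<j j≤n = InI-∷ʳ⁺ (e ∷ʳ j) c ej∈I (m≤n⇒m≤1+n cri≤n) ¬forbids , least
    where
    ej∈I : InI (e ∷ʳ j)
    ej∈I = Equivalence.from (InI-∷ʳ⇔ j) (≤-trans cri≤maxEntry (<⇒≤ max<j) , j≤n)
    ¬forbids : ¬ Forbids (e ∷ʳ j) c
    ¬forbids = ¬Forbids-cri ∘ Forbids-∷ʳ⁻-above e max<j
    least : ∀ y → y < c → ¬ InI (e ∷ʳ j ∷ʳ y)
    least y y<c ejy∈I = proj₂ c-cri y y<c
      (InI-∷ʳ⁺ e y e∈I (≤-trans (<⇒≤ y<c) cri≤n)
        (proj₂ (proj₂ (InI-∷ʳ⁻ (e ∷ʳ j) y ejy∈I)) ∘ Forbids-∷ʳ⁺ˡ e j))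

HasParams-intro : ∀ {n} (e : Vec ℕ n) {c p q M} →
  IsCri e c → maxEntry e ≡ M → c + p ≡ suc M → M + q ≡ n → HasParams e p q
HasParams-intro e {c = c} c-cri refl c+p≡1+m m+q≡n =
  c , c-cri , m+n≡o⇒n≡o∸m c+p≡1+m , m+n≡o⇒n≡o∸m m+q≡n

module Parameters {n} (e : Vec ℕ n) (e∈I : InI e) {c} (c-cri : IsCri e c)
                  {q} (q≡n∸m : q ≡ n ∸ maxEntry e) where

  open CriticalValue e e∈I c-cri

  k : ℕ
  k = maxEntry e ∸ c

  c+k≡m : c + k ≡ maxEntry e
  c+k≡m = m+[n∸m]≡n cri≤maxEntry

  1+m∸c≡1+k : suc (maxEntry e) ∸ c ≡ suc k
  1+m∸c≡1+k = +-∸-assoc 1 cri≤maxEntry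

  c+k+q≡n : c + k + q ≡ n
  c+k+q≡n = trans (cong (_+ q) c+k≡m)
    (trans (cong (maxEntry e +_) q≡n∸m) (m+[n∸m]≡n maxEntry≤n))

  c+k+1+q≡1+n : c + k + suc q ≡ suc n
  c+k+1+q≡1+n = trans (+-suc (c + k) q) (cong suc c+k+q≡n)

  1+n≡c+[1+k+q] : suc n ≡ c + (suc k + q)
  1+n≡c+[1+k+q] = begin
    suc n             ≡⟨ sym c+k+1+q≡1+n ⟩
    c + k + suc q     ≡⟨ +-assoc c k (suc q) ⟩
    c + (k + suc q)   ≡⟨ cong (c +_) (+-suc k q) ⟩
    c + (suc k + q)   ∎
    where open ≡-Reasoning

  1+n∸[1+k+q]≡c : suc n ∸ (suc k + q) ≡ c
  1+n∸[1+k+q]≡c = trans (cong (_∸ (suc k + q)) 1+n≡c+[1+k+q]) (m+n∸n≡m c (suc k + q))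

  1+k+q≤1+n : suc k + q ≤ suc n
  1+k+q≤1+n = subst (suc k + q ≤_) (sym 1+n≡c+[1+k+q]) (m≤n+m (suc k + q) c)

  HasParams-∷ʳ-below : ∀ {t} → t < k → HasParams (e ∷ʳ (c + t)) (k ∸ t) (suc q)
  HasParams-∷ʳ-below {t} t<k =
    HasParams-intro (e ∷ʳ (c + t)) (IsCri-∷ʳ-below (m≤m+n c t) c+t<m)
      (trans (maxEntry-∷ʳ-≤ e (<⇒≤ c+t<m)) (sym c+k≡m))
      (cong suc (trans (+-assoc c t (k ∸ t)) (cong (c +_) (m+[n∸m]≡n (<⇒≤ t<k)))))
      c+k+1+q≡1+n
    where
    c+t<m : c + t < maxEntry e
    c+t<m = subst (c + t <_) c+k≡m (+-monoʳ-< c t<k)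

  HasParams-∷ʳ-maxEntry : HasParams (e ∷ʳ (c + k)) 1 (suc q)
  HasParams-∷ʳ-maxEntry =
    HasParams-intro (e ∷ʳ (c + k))
      (subst (λ m → IsCri (e ∷ʳ m) m) (sym c+k≡m) IsCri-∷ʳ-maxEntry)
      (trans (maxEntry-∷ʳ-≤ e (≤-reflexive c+k≡m)) (sym c+k≡m))
      (+-comm (c + k) 1)
      c+k+1+q≡1+n

  HasParams-∷ʳ-above : ∀ {s} → s < q →
    HasParams (e ∷ʳ (c + suc k + s)) (suc (suc k) + s) (q ∸ s)
  HasParams-∷ʳ-above {s} s<q =
    HasParams-intro (e ∷ʳ (c + suc k + s)) (IsCri-∷ʳ-above m<j j≤n) (maxEntry-∷ʳ-≥ e (<⇒≤ m<j))
      (trans (+-suc c (suc k + s)) (cong suc (sym (+-assoc c (suc k) s))))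
      j+[q∸s]≡1+n
    where
    m<j : maxEntry e < c + suc k + s
    m<j = subst (_< c + suc k + s) c+k≡m
            (<-≤-trans (+-monoʳ-< c (n<1+n k)) (m≤m+n (c + suc k) s))
    j≤n : c + suc k + s ≤ n
    j≤n = subst₂ _≤_ (sym (+-suc-shift c k s)) c+k+q≡n (+-monoʳ-≤ (c + k) s<q)
    j+[q∸s]≡1+n : c + suc k + s + (q ∸ s) ≡ suc n
    j+[q∸s]≡1+n = begin
      c + suc k + s + (q ∸ s)     ≡⟨ +-assoc (c + suc k) s (q ∸ s) ⟩
      c + suc k + (s + (q ∸ s))   ≡⟨ cong (c + suc k +_) (m+[n∸m]≡n (<⇒≤ s<q)) ⟩
      c + suc k + q               ≡⟨ +-suc-shift c k q ⟩
      c + k + suc q               ≡⟨ c+k+1+q≡1+n ⟩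
      suc n                       ∎
      where open ≡-Reasoning

lemma4p3 : (n : ℕ) → 1 ≤ n → (e : Vec ℕ n) → InI e → (p q : ℕ) → HasParams e p q →
    p + q ≤ suc n
    × ((j : ℕ) → InI (e ∷ʳ j) ⇔ ((suc n ∸ (p + q) ≤ j) × (j ≤ n)))
    × ((t : ℕ) → suc t < p → HasParams (e ∷ʳ ((suc n ∸ (p + q)) + t)) (p ∸ suc t) (suc q))
    × HasParams (e ∷ʳ ((suc n ∸ (p + q)) + (p ∸ 1))) 1 (suc q)
    × ((s : ℕ) → s < q → HasParams (e ∷ʳ ((suc n ∸ (p + q)) + p + s)) (suc p + s) (q ∸ s))
lemma4p3 n _ e e∈I p q (c , c-cri , p≡1+m∸c , q≡n∸m)
  with refl ← trans p≡1+m∸c (Parameters.1+m∸c≡1+k e e∈I c-cri q≡n∸m)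
  rewrite Parameters.1+n∸[1+k+q]≡c e e∈I c-cri q≡n∸m =
    1+k+q≤1+n ,
    InI-∷ʳ⇔ ,
    (λ _ → HasParams-∷ʳ-below ∘ s≤s⁻¹) ,
    HasParams-∷ʳ-maxEntry ,
    (λ _ → HasParams-∷ʳ-above)
  where
  open CriticalValue e e∈I c-cri
  open Parameters e e∈I c-cri q≡n∸m
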